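{- Let $n,p>0$ be integers and let $A=A^{p+1}_{n+1}$, $\le$, $\odot$, $\multimap$ be as in the context. For all $a,b,c\in A$: $a\odot b\le c$ if and only if $b\le a\multimap c$. Consequently $\langle A;\odot,\multimap,\wedge,\vee,\bot,\top\rangle$ is a bounded integral commutative residuated lattice.
   Context: Fix integers $n,p>0$. On $\mathbb{Z}\times\mathbb{Z}$ use componentwise addition/subtraction and the lexicographic total order $\preccurlyeq$: $(m,r)\preccurlyeq(k,s)$ iff $m<k$, or $m=k$ and $r\le s$; $\max,\min$ are taken with respect to $\preccurlyeq$. For an integer $j\ge 0$ let $L^\omega_{j+1}=\{(m,r)\in\mathbb{Z}^2:(0,0)\preccurlyeq(m,r)\preccurlyeq(j,0)\}$. On $L^\omega_{n+1}$ put $x*y=\max\{(0,0),x+y-(n,0)\}$ and $x\to y=\min\{(n,0),(n,0)-x+y\}$. Let $L_{p+1}=\{0,1,\dots,p\}$ with the usual order and $\alpha*\beta=\max\{0,\alpha+\beta-p\}$. Let $A=A^{p+1}_{n+1}=(L^\omega_{n+1}\times\{0,p\})\cup(L^\omega_{n}\times\{1,\dots,p-1\})$, with elements written $\langle(m,r),\alpha\rangle$. Define $\langle(m,r),\alpha\rangle\le\langle(k,s),\beta\rangle$ iff either (o1) $0<\alpha\le\beta$ and $(m,r)\preccurlyeq(k,s)$; or (o2) $\alpha=\beta=0$ and $(k,s)\preccurlyeq(m,r)$; or (o3) $\alpha=0<\beta$ and $(n-1,0)\preccurlyeq(m+k,r+s)$. This is a lattice order with meet $\wedge$, join $\vee$,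 least element $\bot=\langle(n,0),0\rangle$ and greatest element $\top=\langle(n,0),p\rangle$. Define the commutative operation $\odot$ on $A$, for $a=\langle(m,r),\alpha\rangle$, $b=\langle(k,s),\beta\rangle$: (i) if $\alpha,\beta>0$ and $\alpha*\beta\neq0$: $a\odot b=\langle(m,r)*(k,s),\alpha*\beta\rangle$; (ii) if $\alpha,\beta>0$ and $\alpha*\beta=0$: $a\odot b=\langle\min\{(n,0),(2n-(m+k+1),-(r+s))\},0\rangle$; (iii) if $\alpha>0$, $\beta=0$: $a\odot b=b\odot a=\langle(m,r)\to(k,s),0\rangle$; (iv) if $\alpha=\beta=0$: $a\odot b=\langle\min\{(n,0),(m+k+1,r+s)\},0\rangle$. Define $\sim\langle(m,r),\alpha\rangle=\langle(m,r),p-\alpha\rangle$ if $\alpha\in\{0,p\}$, and $\sim\langle(m,r),\alpha\rangle=\langle(n-1-m,-r),p-\alpha\rangle$ if $\alpha\notin\{0,p\}$. Define $x\multimap y=\sim(x\odot\sim y)$. A bounded integral commutative residuated lattice is an algebra $\langle A;\odot,\multimap,\wedge,\vee,\bot,\top\rangle$ such that $\langle A;\odot,\top\rangle$ is a commutative monoid, $\langle A;\wedge,\vee,\bot,\top\rangle$ is a bounded lattice, and $a\odot b\le c$ iff $a\le b\multimap c$ for all $a,b,c$. -}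

module Defs where

open import Data.Nat as ℕ using (ℕ; zero; suc)
open import Data.Integer as ℤ using (ℤ; +_; _+_; _-_; -_)
open import Data.Product using (_×_; _,_; Σ; ∃)
open import Data.Sum using (_⊎_)
open import Relation.Nullary using (Dec; yes; no; ¬_)
open import Relation.Nullary.Decidable using (_⊎-dec_; _×-dec_)
open import Relation.Binary.PropositionalEquality using (_≡_)
open import Function.Bundles using (_⇔_)

Z2 : Set
Z2 = ℤ × ℤ

_⊕_ : Z2 → Z2 → Z2
(m , r) ⊕ (k , s) = (m + k , r + s)

_⊖_ : Z2 → Z2 → Z2
(m , r) ⊖ (k , s) = (m - k , r - s)

_≼_ : Z2 → Z2 → Set
(m , r) ≼ (k , s) = (m ℤ.< k) ⊎ ((m ≡ k) × (r ℤ.≤ s))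

_≼?_ : (x y : Z2) → Dec (x ≼ y)
(m , r) ≼? (k , s) = (m ℤ.<? k) ⊎-dec ((m ℤ.≟ k) ×-dec (r ℤ.≤? s))

maxL : Z2 → Z2 → Z2
maxL x y with x ≼? y
... | yes _ = y
... | no  _ = x

minL : Z2 → Z2 → Z2
minL x y with x ≼? y
... | yes _ = x
... | no  _ = y

pt : ℤ → Z2
pt j = (j , + 0)

_*ω[_]_ : Z2 → ℕ → Z2 → Z2
x *ω[ n ] y = maxL (pt (+ 0)) ((x ⊕ y) ⊖ pt (+ n))

_→ω[_]_ : Z2 → ℕ → Z2 → Z2
x →ω[ n ] y = minL (pt (+ n)) ((pt (+ n) ⊖ x) ⊕ y)

_*L[_]_ : ℕ → ℕ → ℕ → ℕ
α *L[ p ] β = (α ℕ.+ β) ℕ.∸ p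

Raw : Set
Raw = Z2 × ℕ

⟨_,_⟩ : Z2 → ℕ → Raw
⟨ x , α ⟩ = (x , α)

-- x ∈ L^ω_{j+1}  (j : ℤ)
InLω : ℤ → Z2 → Set
InLω j x = (pt (+ 0) ≼ x) × (x ≼ pt j)

-- membership in A^{p+1}_{n+1} = (L^ω_{n+1} × {0,p}) ∪ (L^ω_n × {1,…,p-1})
InA : ℕ → ℕ → Raw → Set
InA n p (x , α) =
  (InLω (+ n) x × ((α ≡ 0) ⊎ (α ≡ p)))
  ⊎ (InLω (+ n - + 1) x × ((1 ℕ.≤ α) × (α ℕ.< p)))

Leq : ℕ → Raw → Raw → Set
Leq n ((m , r) , α) ((k , s) , β) =
  ((0 ℕ.< α) × (α ℕ.≤ β) × ((m , r) ≼ (k , s)))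
  ⊎ (((α ≡ 0) × (β ≡ 0)) × ((k , s) ≼ (m , r)))
  ⊎ (((α ≡ 0) × (0 ℕ.< β)) × (pt (+ n - + 1) ≼ ((m , r) ⊕ (k , s))))

bot : ℕ → ℕ → Raw
bot n p = ⟨ pt (+ n) , 0 ⟩

top : ℕ → ℕ → Raw
top n p = ⟨ pt (+ n) , p ⟩

odot : ℕ → ℕ → Raw → Raw → Raw
odot n p ((m , r) , zero) ((k , s) , zero) =
  ⟨ minL (pt (+ n)) (m + k + + 1 , r + s) , 0 ⟩
odot n p ((m , r) , zero) ((k , s) , suc β) =
  ⟨ (k , s) →ω[ n ] (m , r) , 0 ⟩
odot n p ((m , r) , suc α) ((k , s) , zero) =
  ⟨ (m , r) →ω[ n ] (k , s) , 0 ⟩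
odot n p ((m , r) , suc α) ((k , s) , suc β) with (suc α) *L[ p ] (suc β)
... | zero  = ⟨ minL (pt (+ n)) (+ (2 ℕ.* n) - (m + k + + 1) , - (r + s)) , 0 ⟩
... | suc γ = ⟨ (m , r) *ω[ n ] (k , s) , suc γ ⟩

neg : ℕ → ℕ → Raw → Raw
neg n p ((m , r) , α) with α ℕ.≟ 0 | α ℕ.≟ p
... | yes _ | _     = ⟨ (m , r) , p ℕ.∸ α ⟩
... | no _  | yes _ = ⟨ (m , r) , p ℕ.∸ α ⟩
... | no _  | no _  = ⟨ (+ n - + 1 - m , - r) , p ℕ.∸ α ⟩

lolli : ℕ → ℕ → Raw → Raw → Raw
lolli n p x y = neg n p (odot n p x (neg n p y))

record IsBICRL {C : Set} (P : C → Set) (_≤_ : C → C → Set)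
               (_⊙_ _⊸_ : C → C → C) (⊥ ⊤ : C) : Set where
  field
    ⊙-closed : ∀ {a b} → P a → P b → P (a ⊙ b)
    ⊸-closed : ∀ {a b} → P a → P b → P (a ⊸ b)
    ⊥-in     : P ⊥
    ⊤-in     : P ⊤
    ≤-refl    : ∀ {a} → P a → a ≤ a
    ≤-antisym : ∀ {a b} → P a → P b → a ≤ b → b ≤ a → a ≡ b
    ≤-trans   : ∀ {a b c} → P a → P b → P c → a ≤ b → b ≤ c → a ≤ c
    meet : ∀ {a b} → P a → P b →
           Σ C λ m → P m × (m ≤ a) × (m ≤ b) ×
             (∀ {d} → P d → d ≤ a → d ≤ b → d ≤ m)
    join : ∀ {a b} → P a → P b →
           Σ C λ j → P j × (a ≤ j) × (b ≤ j) ×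
             (∀ {d} → P d → a ≤ d → b ≤ d → j ≤ d)
    ⊥-least    : ∀ {a} → P a → ⊥ ≤ a
    ⊤-greatest : ∀ {a} → P a → a ≤ ⊤
    ⊙-assoc  : ∀ {a b c} → P a → P b → P c → ((a ⊙ b) ⊙ c) ≡ (a ⊙ (b ⊙ c))
    ⊙-comm   : ∀ {a b} → P a → P b → (a ⊙ b) ≡ (b ⊙ a)
    ⊙-identʳ : ∀ {a} → P a → (a ⊙ ⊤) ≡ a
    residuated : ∀ {a b c} → P a → P b → P c → ((a ⊙ b) ≤ c) ⇔ (a ≤ (b ⊸ c))

-- Describe ⟨x, α⟩ ∈ A by its degree α and its coordinate x̂ ∈ ℤ², where x̂ = x if α > 0 and
-- x̂ = (n-1,0) - x if α = 0. In coordinates ≤ is the product of ≼ and the order of ℕ, ∼ is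
-- (x̂, α) ↦ ((n-1,0) - x̂, p - α), and
--   (x̂, α) ⊙ (ŷ, β) = (max(floor(α * β), x̂ + ŷ - (n,0)), α * β),
-- where floor(0) = (-1,0) and floor(γ) = (0,0) for γ > 0. Hence a ⊙ b ≤ ∼d amounts to
-- α + β + δ ≤ 2p together with x̂ + ŷ + ẑ ≼ (2n-1,0), a condition symmetric in a, b, d;
-- residuation follows since ∼ is an involution with a ≤ ∼b ⇔ b ≤ ∼a. The monoid laws and
-- the lattice operations (componentwise min and max) are likewise computed in coordinates.

module Submission where

open import Defs
open import Data.Nat as ℕ using (ℕ; zero; suc; z≤n; s≤s; z<s; _<_; _∸_; _⊓_; _⊔_)
import Data.Nat.Properties as ℕ
open import Algebra.Properties.CommutativeSemigroup ℕ.+-commutativeSemigroup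
  using (xy∙z≈xz∙y; xy∙z≈zy∙x)
open import Data.Integer as ℤ using (+_; _+_; _-_; -_)
import Data.Integer.Properties as ℤ
open import Data.Integer.Tactic.RingSolver using (solve-∀)
open import Data.Product using (_×_; _,_; proj₁; proj₂; curry)
open import Data.Product.Properties using (×-≡,≡→≡)
open import Data.Product.Function.NonDependent.Propositional using (_×-⇔_)
open import Data.Sum using (_⊎_; inj₁; inj₂)
open import Data.Empty using (⊥-elim)
open import Relation.Nullary using (yes; no; ¬_)
open import Relation.Binary using (tri<; tri≈; tri>)
open import Relation.Binary.PropositionalEquality
open import Function.Base using (id)
open import Function.Bundles using (_⇔_; mk⇔; Equivalence)
open import Function.Construct.Symmetry using (⇔-sym)
open import Function.Related.Propositional using (module EquationalReasoning)

open Equivalence using (to; from)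

-- The lexicographic order on ℤ²

≼-refl : ∀ {x} → x ≼ x
≼-refl = inj₂ (refl , ℤ.≤-refl)

≼-trans : ∀ {x y z} → x ≼ y → y ≼ z → x ≼ z
≼-trans (inj₁ m<k) (inj₁ k<l) = inj₁ (ℤ.<-trans m<k k<l)
≼-trans (inj₁ m<k) (inj₂ (refl , _)) = inj₁ m<k
≼-trans (inj₂ (refl , _)) (inj₁ k<l) = inj₁ k<l
≼-trans (inj₂ (refl , r≤s)) (inj₂ (refl , s≤t)) = inj₂ (refl , ℤ.≤-trans r≤s s≤t)

≼-antisym : ∀ {x y} → x ≼ y → y ≼ x → x ≡ y
≼-antisym (inj₁ m<k) (inj₁ k<m) = ⊥-elim (ℤ.<-asym m<k k<m)
≼-antisym (inj₁ m<m) (inj₂ (refl , _)) = ⊥-elim (ℤ.<-irrefl refl m<m)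
≼-antisym (inj₂ (refl , _)) (inj₁ m<m) = ⊥-elim (ℤ.<-irrefl refl m<m)
≼-antisym (inj₂ (refl , r≤s)) (inj₂ (_ , s≤r)) = cong (_ ,_) (ℤ.≤-antisym r≤s s≤r)

≼-total : ∀ x y → x ≼ y ⊎ y ≼ x
≼-total (m , r) (k , s) with ℤ.<-cmp m k
... | tri< m<k _ _ = inj₁ (inj₁ m<k)
... | tri> _ _ k<m = inj₂ (inj₁ k<m)
... | tri≈ _ refl _ with ℤ.≤-total r s
...   | inj₁ r≤s = inj₁ (inj₂ (refl , r≤s))
...   | inj₂ s≤r = inj₂ (inj₂ (refl , s≤r))

≰⇒≽ : ∀ {x y} → ¬ x ≼ y → y ≼ x
≰⇒≽ {x} {y} x⋠y with ≼-total x y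
... | inj₁ x≼y = ⊥-elim (x⋠y x≼y)
... | inj₂ y≼x = y≼x

≤⇒≼ : ∀ {m k r} → m ℤ.≤ k → (m , r) ≼ (k , r)
≤⇒≼ {m} {k} m≤k with ℤ.<-cmp m k
... | tri< m<k _ _ = inj₁ m<k
... | tri≈ _ refl _ = ≼-refl
... | tri> _ _ k<m = ⊥-elim (ℤ.<-irrefl refl (ℤ.<-≤-trans k<m m≤k))

⊕-monoˡ-≼ : ∀ {x y} z → x ≼ y → (x ⊕ z) ≼ (y ⊕ z)
⊕-monoˡ-≼ (l , t) (inj₁ m<k) = inj₁ (ℤ.+-monoˡ-< l m<k)
⊕-monoˡ-≼ (l , t) (inj₂ (refl , r≤s)) = inj₂ (refl , ℤ.+-monoˡ-≤ t r≤s)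

-- ≼ is translation invariant, so order facts on ℤ² reduce to ring identities.
≼-by-difference : ∀ {x y x′ y′} → y ⊖ x ≡ y′ ⊖ x′ → x ≼ y → x′ ≼ y′
≼-by-difference {m , r} {k , s} {m′ , r′} {k′ , s′} e x≼y =
  subst₂ _≼_ (×-≡,≡→≡ (shift m m′ , shift r r′))
             (×-≡,≡→≡ (shift′ m k m′ k′ (cong proj₁ e) , shift′ r s r′ s′ (cong proj₂ e)))
             (⊕-monoˡ-≼ _ x≼y)
  where
  shift : ∀ a a′ → a + (a′ - a) ≡ a′
  shift = solve-∀
  shift′ : ∀ a b a′ b′ → b - a ≡ b′ - a′ → b + (a′ - a) ≡ b′
  shift′ a b a′ b′ d = begin
    b + (a′ - a)   ≡⟨ regroup a b a′ ⟩
    (b - a) + a′   ≡⟨ cong (_+ a′) d ⟩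
    (b′ - a′) + a′ ≡⟨ cancel a′ b′ ⟩
    b′             ∎
    where
    open ≡-Reasoning
    regroup : ∀ a b a′ → b + (a′ - a) ≡ (b - a) + a′
    regroup = solve-∀
    cancel : ∀ a′ b′ → (b′ - a′) + a′ ≡ b′
    cancel = solve-∀

⊕-mono-≼ : ∀ {x y u v} → x ≼ y → u ≼ v → (x ⊕ u) ≼ (y ⊕ v)
⊕-mono-≼ {y = k , s} {u₁ , u₂} {v₁ , v₂} x≼y u≼v =
  ≼-trans (⊕-monoˡ-≼ _ x≼y) (≼-by-difference (×-≡,≡→≡ (e k u₁ v₁ , e s u₂ v₂)) u≼v)
  where
  e : ∀ b u v → v - u ≡ (b + v) - (b + u)
  e = solve-∀

⊕-comm : ∀ x y → x ⊕ y ≡ y ⊕ x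
⊕-comm (m , r) (k , s) = ×-≡,≡→≡ (ℤ.+-comm m k , ℤ.+-comm r s)

⊕⊖-cancel : ∀ x y → (x ⊕ y) ⊖ y ≡ x
⊕⊖-cancel (x₁ , x₂) (y₁ , y₂) = ×-≡,≡→≡ (e x₁ y₁ , e x₂ y₂)
  where
  e : ∀ x y → (x + y) - y ≡ x
  e = solve-∀

⊖-involutive : ∀ c x → c ⊖ (c ⊖ x) ≡ x
⊖-involutive (l , t) (m , r) = ×-≡,≡→≡ (e l m , e t r)
  where
  e : ∀ c x → c - (c - x) ≡ x
  e = solve-∀

⊖-antitone : ∀ c {x y} → x ≼ y → (c ⊖ y) ≼ (c ⊖ x)
⊖-antitone (l , t) {m , r} {k , s} = ≼-by-difference (×-≡,≡→≡ (e l m k , e t r s))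
  where
  e : ∀ c x y → y - x ≡ (c - x) - (c - y)
  e = solve-∀

⊖-antitone⁻¹ : ∀ c {x y} → (c ⊖ y) ≼ (c ⊖ x) → x ≼ y
⊖-antitone⁻¹ c {x} {y} h =
  subst₂ _≼_ (⊖-involutive c x) (⊖-involutive c y) (⊖-antitone c h)

≼⊖-swap : ∀ c {x y} → x ≼ (c ⊖ y) → y ≼ (c ⊖ x)
≼⊖-swap c {x} {y} h = subst (_≼ (c ⊖ x)) (⊖-involutive c y) (⊖-antitone c h)

⊖≼-swap : ∀ c {x y} → (c ⊖ x) ≼ y → (c ⊖ y) ≼ x
⊖≼-swap c {x} {y} h = subst ((c ⊖ y) ≼_) (⊖-involutive c x) (⊖-antitone c h)

≼⊕⇔⊖≼ : ∀ x y z → x ≼ (y ⊕ z) ⇔ (x ⊖ y) ≼ z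
≼⊕⇔⊖≼ (x₁ , x₂) (y₁ , y₂) (z₁ , z₂) =
  mk⇔ (≼-by-difference (×-≡,≡→≡ (e x₁ y₁ z₁ , e x₂ y₂ z₂)))
      (≼-by-difference (×-≡,≡→≡ (sym (e x₁ y₁ z₁) , sym (e x₂ y₂ z₂))))
  where
  e : ∀ x y z → (y + z) - x ≡ z - (x - y)
  e = solve-∀

⊖≼⊖⇔⊕≼⊕ : ∀ x y z u → (x ⊖ y) ≼ (z ⊖ u) ⇔ (x ⊕ u) ≼ (z ⊕ y)
⊖≼⊖⇔⊕≼⊕ (x₁ , x₂) (y₁ , y₂) (z₁ , z₂) (u₁ , u₂) =
  mk⇔ (≼-by-difference (×-≡,≡→≡ (e x₁ y₁ z₁ u₁ , e x₂ y₂ z₂ u₂)))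
      (≼-by-difference (×-≡,≡→≡ (sym (e x₁ y₁ z₁ u₁) , sym (e x₂ y₂ z₂ u₂))))
  where
  e : ∀ x y z u → (z - u) - (x - y) ≡ (z + y) - (x + u)
  e = solve-∀

⊕⊖-absorb : ∀ x {v w} → v ≼ w → ((x ⊕ v) ⊖ w) ≼ x
⊕⊖-absorb (x₁ , x₂) {v₁ , v₂} {w₁ , w₂} =
  ≼-by-difference (×-≡,≡→≡ (e x₁ v₁ w₁ , e x₂ v₂ w₂))
  where
  e : ∀ x v w → w - v ≡ x - ((x + v) - w)
  e = solve-∀

⊕⊖-monoˡ-≼ : ∀ u w {x y} → x ≼ y → ((x ⊕ u) ⊖ w) ≼ ((y ⊕ u) ⊖ w)
⊕⊖-monoˡ-≼ (u₁ , u₂) (w₁ , w₂) {x₁ , x₂} {y₁ , y₂} =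
  ≼-by-difference (×-≡,≡→≡ (e x₁ y₁ u₁ w₁ , e x₂ y₂ u₂ w₂))
  where
  e : ∀ x y u w → y - x ≡ ((y + u) - w) - ((x + u) - w)
  e = solve-∀

Monotone Antitone : (Z2 → Z2) → Set
Monotone f = ∀ {x y} → x ≼ y → f x ≼ f y
Antitone f = ∀ {x y} → x ≼ y → f y ≼ f x

maxL-right : ∀ {x y} → x ≼ y → maxL x y ≡ y
maxL-right {x} {y} x≼y with x ≼? y
... | yes _ = refl
... | no x⋠y = ⊥-elim (x⋠y x≼y)

maxL-left : ∀ {x y} → y ≼ x → maxL x y ≡ x
maxL-left {x} {y} y≼x with x ≼? y
... | yes x≼y = ≼-antisym y≼x x≼y
... | no _ = refl

minL-left : ∀ {x y} → x ≼ y → minL x y ≡ x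
minL-left {x} {y} x≼y with x ≼? y
... | yes _ = refl
... | no x⋠y = ⊥-elim (x⋠y x≼y)

minL-right : ∀ {x y} → y ≼ x → minL x y ≡ y
minL-right {x} {y} y≼x with x ≼? y
... | yes x≼y = ≼-antisym x≼y y≼x
... | no _ = refl

x≼maxL : ∀ x y → x ≼ maxL x y
x≼maxL x y with x ≼? y
... | yes x≼y = x≼y
... | no _ = ≼-refl

y≼maxL : ∀ x y → y ≼ maxL x y
y≼maxL x y with x ≼? y
... | yes _ = ≼-refl
... | no x⋠y = ≰⇒≽ x⋠y

maxL-lub : ∀ {x y z} → x ≼ z → y ≼ z → maxL x y ≼ z
maxL-lub {x} {y} x≼z y≼z with x ≼? y
... | yes _ = y≼z
... | no _ = x≼z

minL≼x : ∀ x y → minL x y ≼ x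
minL≼x x y with x ≼? y
... | yes _ = ≼-refl
... | no x⋠y = ≰⇒≽ x⋠y

minL≼y : ∀ x y → minL x y ≼ y
minL≼y x y with x ≼? y
... | yes x≼y = x≼y
... | no _ = ≼-refl

minL-glb : ∀ {x y z} → z ≼ x → z ≼ y → z ≼ minL x y
minL-glb {x} {y} z≼x z≼y with x ≼? y
... | yes _ = z≼x
... | no _ = z≼y

monotone-maxL : ∀ {f} → Monotone f → ∀ x y → f (maxL x y) ≡ maxL (f x) (f y)
monotone-maxL {f} mono x y with ≼-total x y
... | inj₁ x≼y = trans (cong f (maxL-right x≼y)) (sym (maxL-right (mono x≼y)))
... | inj₂ y≼x = trans (cong f (maxL-left y≼x)) (sym (maxL-left (mono y≼x)))

antitone-minL : ∀ {f} → Antitone f → ∀ x y → f (minL x y) ≡ maxL (f x) (f y)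
antitone-minL {f} anti x y with ≼-total x y
... | inj₁ x≼y = trans (cong f (minL-left x≼y)) (sym (maxL-left (anti x≼y)))
... | inj₂ y≼x = trans (cong f (minL-right y≼x)) (sym (maxL-right (anti y≼x)))

maxL-absorb : ∀ {x y z} → y ≼ x → maxL x (maxL y z) ≡ maxL x z
maxL-absorb {x} {y} {z} y≼x with ≼-total y z
... | inj₁ y≼z = cong (maxL x) (maxL-right y≼z)
... | inj₂ z≼y = begin
  maxL x (maxL y z) ≡⟨ cong (maxL x) (maxL-left z≼y) ⟩
  maxL x y          ≡⟨ maxL-left y≼x ⟩
  x                 ≡⟨ maxL-left (≼-trans z≼y y≼x) ⟨
  maxL x z          ∎
  where open ≡-Reasoning

-- Łukasiewicz arithmetic

*L-comm : ∀ P α β → α *L[ P ] β ≡ β *L[ P ] α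
*L-comm P α β = cong (_∸ P) (ℕ.+-comm α β)

*L-identityʳ : ∀ P α → α *L[ P ] P ≡ α
*L-identityʳ P α = ℕ.m+n∸n≡m α P

*L-zeroʳ : ∀ {P α} → α ℕ.≤ P → α *L[ P ] 0 ≡ 0
*L-zeroʳ {P} {α} α≤P = trans (cong (_∸ P) (ℕ.+-identityʳ α)) (ℕ.m≤n⇒m∸n≡0 α≤P)

*L-decreasingˡ : ∀ {P α β} → β ℕ.≤ P → α *L[ P ] β ℕ.≤ α
*L-decreasingˡ {P} {α} β≤P =
  ℕ.≤-trans (ℕ.∸-monoˡ-≤ P (ℕ.+-monoʳ-≤ α β≤P)) (ℕ.≤-reflexive (ℕ.m+n∸n≡m α P))

*L-assoc-∸ : ∀ {P} α β {γ} → γ ℕ.≤ P →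
             (α *L[ P ] β) *L[ P ] γ ≡ (α ℕ.+ β ℕ.+ γ) ∸ (P ℕ.+ P)
*L-assoc-∸ {P} α β {γ} γ≤P with P ℕ.≤? α ℕ.+ β
... | yes P≤α+β =
  trans (cong (_∸ P) (sym (ℕ.+-∸-comm γ P≤α+β))) (ℕ.∸-+-assoc (α ℕ.+ β ℕ.+ γ) P P)
... | no P≰α+β = begin
  (α *L[ P ] β) *L[ P ] γ     ≡⟨ cong (λ δ → (δ ℕ.+ γ) ∸ P) (ℕ.m≤n⇒m∸n≡0 α+β≤P) ⟩
  γ ∸ P                       ≡⟨ ℕ.m≤n⇒m∸n≡0 γ≤P ⟩
  0                           ≡⟨ ℕ.m≤n⇒m∸n≡0 (ℕ.+-mono-≤ α+β≤P γ≤P) ⟨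
  (α ℕ.+ β ℕ.+ γ) ∸ (P ℕ.+ P) ∎
  where
  open ≡-Reasoning
  α+β≤P = ℕ.<⇒≤ (ℕ.≰⇒> P≰α+β)

*L<⇒ : ∀ {P α β} → α ℕ.≤ P → β ℕ.≤ P → α *L[ P ] β < P → α < P ⊎ β < P
*L<⇒ {P} {α} {β} α≤P β≤P αβ<P with α ℕ.<? P | β ℕ.<? P
... | yes α<P | _ = inj₁ α<P
... | no _ | yes β<P = inj₂ β<P
... | no α≮P | no β≮P with ℕ.≤-antisym α≤P (ℕ.≮⇒≥ α≮P) | ℕ.≤-antisym β≤P (ℕ.≮⇒≥ β≮P)
...   | refl | refl = ⊥-elim (ℕ.<-irrefl (*L-identityʳ P P) αβ<P)

*L≤∸⇔ : ∀ {P α β δ} → δ ℕ.≤ P → α *L[ P ] β ℕ.≤ P ∸ δ ⇔ α ℕ.+ β ℕ.+ δ ℕ.≤ P ℕ.+ P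
*L≤∸⇔ {P} {α} {β} {δ} δ≤P with P ℕ.≤? α ℕ.+ β
... | yes P≤α+β = mk⇔
  (λ h → subst (ℕ._≤ P ℕ.+ P) regroup (ℕ.+-monoˡ-≤ P (ℕ.m≤o∸n⇒m+n≤o _ δ≤P h)))
  (λ h → ℕ.m+n≤o⇒m≤o∸n _ (ℕ.+-cancelʳ-≤ P _ _ (subst (ℕ._≤ P ℕ.+ P) (sym regroup) h)))
  where
  γ = (α ℕ.+ β) ∸ P
  regroup : γ ℕ.+ δ ℕ.+ P ≡ α ℕ.+ β ℕ.+ δ
  regroup = begin
    γ ℕ.+ δ ℕ.+ P ≡⟨ xy∙z≈xz∙y γ δ P ⟩
    γ ℕ.+ P ℕ.+ δ ≡⟨ cong (ℕ._+ δ) (ℕ.m∸n+n≡m P≤α+β) ⟩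
    α ℕ.+ β ℕ.+ δ ∎
    where open ≡-Reasoning
... | no P≰α+β = mk⇔ (λ _ → ℕ.+-mono-≤ α+β≤P δ≤P)
                     (λ _ → subst (ℕ._≤ P ∸ δ) (sym (ℕ.m≤n⇒m∸n≡0 α+β≤P)) z≤n)
  where α+β≤P = ℕ.<⇒≤ (ℕ.≰⇒> P≰α+β)

0<∸⇒< : ∀ {P δ} → 0 < P ∸ δ → δ < P
0<∸⇒< {P} {δ} 0<P∸δ with δ ℕ.<? P
... | yes δ<P = δ<P
... | no δ≮P = ⊥-elim (ℕ.<-irrefl (sym (ℕ.m≤n⇒m∸n≡0 (ℕ.≮⇒≥ δ≮P))) 0<P∸δ)

≤∸-swap : ∀ {P α δ} → δ ℕ.≤ P → α ℕ.≤ P ∸ δ → δ ℕ.≤ P ∸ α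
≤∸-swap {P} {α} {δ} δ≤P α≤P∸δ =
  ℕ.m+n≤o⇒m≤o∸n δ (subst (ℕ._≤ P) (ℕ.+-comm α δ) (ℕ.m≤o∸n⇒m+n≤o α δ≤P α≤P∸δ))

-- Coordinates on A

module _ (n₀ p₀ : ℕ) where

  private
    n p : ℕ
    n = suc n₀
    p = suc p₀

  c N : Z2
  c = pt (+ n - + 1)
  N = pt (+ n)

  floor : ℕ → Z2
  floor zero = pt (- + 1)
  floor (suc _) = pt (+ 0)

  deg : Raw → ℕ
  deg = proj₂

  coord : Raw → Z2
  coord (x , zero) = c ⊖ x
  coord (x , suc _) = x

  infix 4 _⊑_
  _⊑_ : Raw → Raw → Set
  a ⊑ b = coord a ≼ coord b × deg a ℕ.≤ deg b

  record InRange (v : Z2) (k : ℕ) : Set where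
    field
      floor≼ : floor k ≼ v
      ≼N     : v ≼ N
      deg≤p  : k ℕ.≤ p
      ≼c     : k < p → v ≼ c

  open InRange

  Admissible : Raw → Set
  Admissible a = InRange (coord a) (deg a)

  infixl 7 _⊙_
  _⊙_ : Raw → Raw → Raw
  _⊙_ = odot n p

  _*p_ : ℕ → ℕ → ℕ
  α *p β = α *L[ p ] β

  infix 8 ∼_
  ∼_ : Raw → Raw
  ∼_ = neg n p

  c⊖N≡floor0 : c ⊖ N ≡ floor 0
  c⊖N≡floor0 = ×-≡,≡→≡ (e (+ n) , refl)
    where
    e : ∀ m → (m - + 1) - m ≡ - + 1
    e = solve-∀

  c⊖0≡c : c ⊖ pt (+ 0) ≡ c
  c⊖0≡c = ×-≡,≡→≡ (ℤ.+-identityʳ (+ n - + 1) , refl)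

  c⊖c≡0 : c ⊖ c ≡ pt (+ 0)
  c⊖c≡0 = ×-≡,≡→≡ (ℤ.+-inverseʳ (+ n - + 1) , refl)

  0≼c : pt (+ 0) ≼ c
  0≼c = ≤⇒≼ (ℤ.i≤j⇒0≤j-i (ℤ.+≤+ (s≤s z≤n)))

  c≼N : c ≼ N
  c≼N = ≤⇒≼ (ℤ.i-j≤i (+ n) (+ 1))

  floor-mono : ∀ {α β} → α ℕ.≤ β → floor α ≼ floor β
  floor-mono {zero} {zero} _ = ≼-refl
  floor-mono {zero} {suc _} _ = inj₁ ℤ.-<+
  floor-mono {suc _} {suc _} _ = ≼-refl

  floor0≼ : ∀ α → floor 0 ≼ floor α
  floor0≼ α = floor-mono {β = α} z≤n

  floor≼c : ∀ α → floor α ≼ c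
  floor≼c zero = ≼-trans (floor0≼ 1) 0≼c
  floor≼c (suc _) = 0≼c

  floor≼N : ∀ α → floor α ≼ N
  floor≼N α = ≼-trans (floor≼c α) c≼N

  Leq⇒⊑ : ∀ {a b} → Leq n a b → a ⊑ b
  Leq⇒⊑ (inj₁ (s≤s z≤n , α≤β@(s≤s _) , x≼y)) = x≼y , α≤β
  Leq⇒⊑ (inj₂ (inj₁ ((refl , refl) , y≼x))) = ⊖-antitone c y≼x , z≤n
  Leq⇒⊑ {x , _} {y , _} (inj₂ (inj₂ ((refl , s≤s z≤n) , c≼x⊕y))) =
    to (≼⊕⇔⊖≼ c x y) c≼x⊕y , z≤n

  ⊑⇒Leq : ∀ {a b} → a ⊑ b → Leq n a b
  ⊑⇒Leq {x , zero} {y , zero} (h , _) = inj₂ (inj₁ ((refl , refl) , ⊖-antitone⁻¹ c h))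
  ⊑⇒Leq {x , zero} {y , suc _} (h , _) = inj₂ (inj₂ ((refl , s≤s z≤n) , from (≼⊕⇔⊖≼ c x y) h))
  ⊑⇒Leq {x , suc _} {y , suc _} (h , α≤β) = inj₁ (s≤s z≤n , α≤β , h)

  Leq⇔⊑ : ∀ {a b} → Leq n a b ⇔ a ⊑ b
  Leq⇔⊑ = mk⇔ Leq⇒⊑ ⊑⇒Leq

  ⊑⇔ : ∀ {a b v k w l} → coord a ≡ v → deg a ≡ k → coord b ≡ w → deg b ≡ l →
       a ⊑ b ⇔ (v ≼ w × k ℕ.≤ l)
  ⊑⇔ refl refl refl refl = mk⇔ id id

  coord-injective : ∀ {a b} → deg a ≡ deg b → coord a ≡ coord b → a ≡ b
  coord-injective {x , zero} {y , zero} refl e = cong (_, 0) (begin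
    x           ≡⟨ ⊖-involutive c x ⟨
    c ⊖ (c ⊖ x) ≡⟨ cong (c ⊖_) e ⟩
    c ⊖ (c ⊖ y) ≡⟨ ⊖-involutive c y ⟩
    y           ∎)
    where open ≡-Reasoning
  coord-injective {x , suc _} {y , suc _} refl e = cong (_, _) e

  ⊑-trans : ∀ {a b d} → a ⊑ b → b ⊑ d → a ⊑ d
  ⊑-trans (x≼y , α≤β) (y≼z , β≤γ) = ≼-trans x≼y y≼z , ℕ.≤-trans α≤β β≤γ

  ⊑-antisym : ∀ {a b} → a ⊑ b → b ⊑ a → a ≡ b
  ⊑-antisym (x≼y , α≤β) (y≼x , β≤α) =
    coord-injective (ℕ.≤-antisym α≤β β≤α) (≼-antisym x≼y y≼x)

  deg-neg : ∀ a → deg (∼ a) ≡ p ∸ deg a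
  deg-neg (x , α) with α ℕ.≟ 0 | α ℕ.≟ p
  ... | yes _ | _ = refl
  ... | no _ | yes _ = refl
  ... | no _ | no _ = refl

  coord-neg : ∀ a → deg a ℕ.≤ p → coord (∼ a) ≡ c ⊖ coord a
  coord-neg (x , zero) _ = sym (⊖-involutive c x)
  coord-neg ((m , r) , suc α) α≤p with suc α ℕ.≟ p
  ... | yes refl rewrite ℕ.n∸n≡0 p₀ = refl
  ... | no α≢p with p ∸ suc α | ℕ.m<n⇒0<n∸m (ℕ.≤∧≢⇒< α≤p α≢p)
  ...   | suc _ | _ = ×-≡,≡→≡ (refl , sym (ℤ.+-identityˡ (- r)))

  ≼N⇔floor0≼ : ∀ {x} → x ≼ N ⇔ floor 0 ≼ (c ⊖ x)
  ≼N⇔floor0≼ {x} = mk⇔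
    (λ x≼N → subst (_≼ (c ⊖ x)) c⊖N≡floor0 (⊖-antitone c x≼N))
    (λ h → ⊖-antitone⁻¹ c (subst (_≼ (c ⊖ x)) (sym c⊖N≡floor0) h))

  0≼⇔≼c : ∀ {x} → pt (+ 0) ≼ x ⇔ (c ⊖ x) ≼ c
  0≼⇔≼c {x} = mk⇔
    (λ 0≼x → subst ((c ⊖ x) ≼_) c⊖0≡c (⊖-antitone c 0≼x))
    (λ h → ⊖-antitone⁻¹ c (subst ((c ⊖ x) ≼_) (sym c⊖0≡c) h))

  ≼c⇒0≼ : ∀ {x} → x ≼ c → pt (+ 0) ≼ (c ⊖ x)
  ≼c⇒0≼ {x} x≼c = subst (_≼ (c ⊖ x)) c⊖c≡0 (⊖-antitone c x≼c)

  InA⇒Admissible : ∀ {a} → InA n p a → Admissible a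
  InA⇒Admissible (inj₁ ((0≼x , x≼N) , inj₁ refl)) = record
    { floor≼ = to ≼N⇔floor0≼ x≼N
    ; ≼N = ≼-trans (to 0≼⇔≼c 0≼x) c≼N
    ; deg≤p = z≤n
    ; ≼c = λ _ → to 0≼⇔≼c 0≼x
    }
  InA⇒Admissible (inj₁ ((0≼x , x≼N) , inj₂ refl)) = record
    { floor≼ = 0≼x ; ≼N = x≼N ; deg≤p = ℕ.≤-refl ; ≼c = λ p<p → ⊥-elim (ℕ.<-irrefl refl p<p) }
  InA⇒Admissible {x , suc _} (inj₂ ((0≼x , x≼c) , (_ , α<p))) = record
    { floor≼ = 0≼x ; ≼N = ≼-trans x≼c c≼N ; deg≤p = ℕ.<⇒≤ α<p ; ≼c = λ _ → x≼c }

  Admissible⇒InA : ∀ {a} → Admissible a → InA n p a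
  Admissible⇒InA {x , zero} adm =
    inj₁ ((from 0≼⇔≼c (≼c adm z<s) , from ≼N⇔floor0≼ (floor≼ adm)) , inj₁ refl)
  Admissible⇒InA {x , suc α} adm with suc α ℕ.≟ p
  ... | yes α≡p = inj₁ ((floor≼ adm , ≼N adm) , inj₂ α≡p)
  ... | no α≢p = inj₂ ((floor≼ adm , ≼c adm α<p) , (s≤s z≤n , α<p))
    where α<p = ℕ.≤∧≢⇒< (deg≤p adm) α≢p

  deg-⊙ : ∀ a b → deg a ℕ.≤ p → deg b ℕ.≤ p → deg (a ⊙ b) ≡ deg a *p deg b
  deg-⊙ (x , zero) (y , zero) _ _ = refl
  deg-⊙ (x , zero) (y , suc β) _ β≤p = sym (ℕ.m≤n⇒m∸n≡0 β≤p)
  deg-⊙ (x , suc α) (y , zero) α≤p _ = sym (*L-zeroʳ α≤p)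
  deg-⊙ (x , suc α) (y , suc β) _ _ with suc α *p suc β
  ... | zero = refl
  ... | suc _ = refl

  coord-minL-N : ∀ w → coord (minL N w , 0) ≡ maxL (floor 0) (c ⊖ w)
  coord-minL-N w =
    trans (antitone-minL (⊖-antitone c) N w) (cong (λ z → maxL z (c ⊖ w)) c⊖N≡floor0)

  coord-⊙ : ∀ a b → deg a ℕ.≤ p → deg b ℕ.≤ p →
            coord (a ⊙ b) ≡ maxL (floor (deg a *p deg b)) ((coord a ⊕ coord b) ⊖ N)
  coord-⊙ ((m , r) , zero) ((k , s) , zero) _ _ =
    trans (coord-minL-N (m + k + + 1 , r + s))
          (cong (maxL (floor 0)) (×-≡,≡→≡ (e (+ n) m k , e₂ r s)))
    where
    e : ∀ N m k → (N - + 1) - (m + k + + 1) ≡ (((N - + 1) - m) + ((N - + 1) - k)) - N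
    e = solve-∀
    e₂ : ∀ r s → + 0 - (r + s) ≡ ((+ 0 - r) + (+ 0 - s)) - + 0
    e₂ = solve-∀
  coord-⊙ ((m , r) , zero) ((k , s) , suc β) _ β≤p =
    trans (coord-minL-N ((N ⊖ (k , s)) ⊕ (m , r)))
          (cong₂ maxL (cong floor (sym (ℕ.m≤n⇒m∸n≡0 β≤p))) (×-≡,≡→≡ (e (+ n) m k , e₂ r s)))
    where
    e : ∀ N m k → (N - + 1) - ((N - k) + m) ≡ (((N - + 1) - m) + k) - N
    e = solve-∀
    e₂ : ∀ r s → + 0 - ((+ 0 - s) + r) ≡ ((+ 0 - r) + s) - + 0
    e₂ = solve-∀
  coord-⊙ ((m , r) , suc α) ((k , s) , zero) α≤p _ =
    trans (coord-minL-N ((N ⊖ (m , r)) ⊕ (k , s)))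
          (cong₂ maxL (cong floor (sym (*L-zeroʳ α≤p))) (×-≡,≡→≡ (e (+ n) m k , e₂ r s)))
    where
    e : ∀ N m k → (N - + 1) - ((N - m) + k) ≡ (m + ((N - + 1) - k)) - N
    e = solve-∀
    e₂ : ∀ r s → + 0 - ((+ 0 - r) + s) ≡ (r + (+ 0 - s)) - + 0
    e₂ = solve-∀
  coord-⊙ ((m , r) , suc α) ((k , s) , suc β) _ _ with suc α *p suc β
  ... | suc _ = refl
  ... | zero =
    trans (coord-minL-N (+ (2 ℕ.* n) - (m + k + + 1) , - (r + s)))
          (cong (maxL (floor 0)) (×-≡,≡→≡ (e₁ , e₂ r s)))
    where
    e : ∀ N m k → (N - + 1) - ((N + N) - (m + k + + 1)) ≡ (m + k) - N
    e = solve-∀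
    e₁ : (+ n - + 1) - (+ (2 ℕ.* n) - (m + k + + 1)) ≡ (m + k) - + n
    e₁ rewrite ℕ.+-identityʳ n | ℤ.pos-+ n n = e (+ n) m k
    e₂ : ∀ r s → + 0 - (- (r + s)) ≡ (r + s) - + 0
    e₂ = solve-∀

  floor≼c⊖ : ∀ {d} → Admissible d → ∀ γ → γ ℕ.≤ p ∸ deg d → floor γ ≼ (c ⊖ coord d)
  floor≼c⊖ adm zero _ = to ≼N⇔floor0≼ (≼N adm)
  floor≼c⊖ adm (suc _) γ≤p∸δ = ≼c⇒0≼ (≼c adm (0<∸⇒< (ℕ.<-≤-trans z<s γ≤p∸δ)))

  Admissible-neg : ∀ {a} → Admissible a → Admissible (∼ a)
  Admissible-neg {a} adm =
    subst₂ InRange (sym (coord-neg a (deg≤p adm))) (sym (deg-neg a)) (record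
      { floor≼ = floor≼c⊖ adm (p ∸ deg a) ℕ.≤-refl
      ; ≼N = ⊖≼-swap c (subst (_≼ coord a) (sym c⊖N≡floor0)
                               (≼-trans (floor0≼ (deg a)) (floor≼ adm)))
      ; deg≤p = ℕ.m∸n≤m p (deg a)
      ; ≼c = ≼c′ (deg a) (floor≼ adm)
      })
    where
    ≼c′ : ∀ α → floor α ≼ coord a → p ∸ α < p → (c ⊖ coord a) ≼ c
    ≼c′ zero _ p<p = ⊥-elim (ℕ.<-irrefl refl p<p)
    ≼c′ (suc _) 0≼x _ = to 0≼⇔≼c 0≼x

  Admissible-⊙ : ∀ {a b} → Admissible a → Admissible b → Admissible (a ⊙ b)
  Admissible-⊙ {a} {b} adm₁ adm₂ =
    subst₂ InRange (sym (coord-⊙ a b (deg≤p adm₁) (deg≤p adm₂)))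
                   (sym (deg-⊙ a b (deg≤p adm₁) (deg≤p adm₂))) (record
      { floor≼ = x≼maxL (floor γ) s
      ; ≼N = maxL-lub (floor≼N γ) (to (≼⊕⇔⊖≼ _ N N) (⊕-mono-≼ (≼N adm₁) (≼N adm₂)))
      ; deg≤p = ℕ.≤-trans (*L-decreasingˡ (deg≤p adm₂)) (deg≤p adm₁)
      ; ≼c = λ γ<p → maxL-lub (floor≼c γ) (s≼c (*L<⇒ (deg≤p adm₁) (deg≤p adm₂) γ<p))
      })
    where
    γ = deg a *p deg b
    s = (coord a ⊕ coord b) ⊖ N
    s≼c : deg a < p ⊎ deg b < p → s ≼ c
    s≼c (inj₁ α<p) = to (≼⊕⇔⊖≼ _ N c)
      (subst ((coord a ⊕ coord b) ≼_) (⊕-comm c N) (⊕-mono-≼ (≼c adm₁ α<p) (≼N adm₂)))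
    s≼c (inj₂ β<p) = to (≼⊕⇔⊖≼ _ N c) (⊕-mono-≼ (≼N adm₁) (≼c adm₂ β<p))

  Admissible-⊤ : Admissible (top n p)
  Admissible-⊤ = record
    { floor≼ = floor≼N p ; ≼N = ≼-refl ; deg≤p = ℕ.≤-refl
    ; ≼c = λ p<p → ⊥-elim (ℕ.<-irrefl refl p<p) }

  Admissible-⊥ : Admissible (bot n p)
  Admissible-⊥ = record
    { floor≼ = to ≼N⇔floor0≼ ≼-refl
    ; ≼N = subst (_≼ N) (sym c⊖N≡floor0) (floor≼N 0)
    ; deg≤p = z≤n
    ; ≼c = λ _ → subst (_≼ c) (sym c⊖N≡floor0) (floor≼c 0)
    }

  neg-involutive : ∀ {a} → Admissible a → ∼ ∼ a ≡ a
  neg-involutive {a} adm = coord-injective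
    (begin
      deg (∼ ∼ a)     ≡⟨ deg-neg (∼ a) ⟩
      p ∸ deg (∼ a)   ≡⟨ cong (p ∸_) (deg-neg a) ⟩
      p ∸ (p ∸ deg a) ≡⟨ ℕ.m∸[m∸n]≡n (deg≤p adm) ⟩
      deg a           ∎)
    (begin
      coord (∼ ∼ a)     ≡⟨ coord-neg (∼ a) (deg≤p (Admissible-neg adm)) ⟩
      c ⊖ coord (∼ a)   ≡⟨ cong (c ⊖_) (coord-neg a (deg≤p adm)) ⟩
      c ⊖ (c ⊖ coord a) ≡⟨ ⊖-involutive c (coord a) ⟩
      coord a           ∎)
    where open ≡-Reasoning

  ⊑∼-swap : ∀ {a b} → Admissible a → Admissible b → a ⊑ ∼ b → b ⊑ ∼ a
  ⊑∼-swap {a} {b} adm₁ adm₂ (x≼ , α≤) =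
    subst (coord b ≼_) (sym (coord-neg a (deg≤p adm₁)))
          (≼⊖-swap c (subst (coord a ≼_) (coord-neg b (deg≤p adm₂)) x≼)) ,
    subst (deg b ℕ.≤_) (sym (deg-neg a))
          (≤∸-swap (deg≤p adm₂) (subst (deg a ℕ.≤_) (deg-neg b) α≤))

  ≤∼-swap : ∀ {a b} → Admissible a → Admissible b → Leq n a (∼ b) → Leq n b (∼ a)
  ≤∼-swap adm₁ adm₂ h = ⊑⇒Leq (⊑∼-swap adm₁ adm₂ (Leq⇒⊑ h))

  Balanced : Raw → Raw → Raw → Set
  Balanced a b d = ((coord a ⊕ coord b) ⊕ coord d) ≼ (c ⊕ N)
                 × deg a ℕ.+ deg b ℕ.+ deg d ℕ.≤ p ℕ.+ p

  Balanced-swap : ∀ {a b d} → Balanced a b d → Balanced a d b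
  Balanced-swap {a} {b} {d} (coords , degs) =
    subst (_≼ (c ⊕ N)) (×-≡,≡→≡ (e x₁ y₁ z₁ , e x₂ y₂ z₂)) coords ,
    subst (ℕ._≤ p ℕ.+ p) (xy∙z≈xz∙y (deg a) (deg b) (deg d)) degs
    where
    x₁ = proj₁ (coord a) ; x₂ = proj₂ (coord a)
    y₁ = proj₁ (coord b) ; y₂ = proj₂ (coord b)
    z₁ = proj₁ (coord d) ; z₂ = proj₂ (coord d)
    e : ∀ x y z → (x + y) + z ≡ (x + z) + y
    e = solve-∀

  -- Balanced a b d is symmetric in a, b, d; this is what yields residuation.
  ⊙≤∼⇔Balanced : ∀ {a b d} → Admissible a → Admissible b → Admissible d →
                 Leq n (a ⊙ b) (∼ d) ⇔ Balanced a b d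
  ⊙≤∼⇔Balanced {a} {b} {d} adm₁ adm₂ adm₃ = begin
    Leq n (a ⊙ b) (∼ d)
      ∼⟨ Leq⇔⊑ ⟩
    a ⊙ b ⊑ ∼ d
      ∼⟨ ⊑⇔ (coord-⊙ a b α≤p β≤p) (deg-⊙ a b α≤p β≤p) (coord-neg d δ≤p) (deg-neg d) ⟩
    (maxL (floor γ) s ≼ (c ⊖ coord d) × γ ℕ.≤ p ∸ deg d)
      ∼⟨ mk⇔ (λ (h , γ≤) → ≼-trans (y≼maxL (floor γ) s) h , γ≤)
             (λ (h , γ≤) → maxL-lub (floor≼c⊖ adm₃ γ γ≤) h , γ≤) ⟩
    (s ≼ (c ⊖ coord d) × γ ℕ.≤ p ∸ deg d)
      ∼⟨ ⊖≼⊖⇔⊕≼⊕ (coord a ⊕ coord b) N c (coord d) ×-⇔ *L≤∸⇔ {α = deg a} δ≤p ⟩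
    Balanced a b d
      ∎
    where
    open EquationalReasoning
    α≤p = deg≤p adm₁
    β≤p = deg≤p adm₂
    δ≤p = deg≤p adm₃
    γ = deg a *p deg b
    s = (coord a ⊕ coord b) ⊖ N

  residuation : ∀ {a b d} → Admissible a → Admissible b → Admissible d →
                Leq n (a ⊙ b) d ⇔ Leq n b (lolli n p a d)
  residuation {a} {b} {d} adm₁ adm₂ adm₃ = begin
    Leq n (a ⊙ b) d        ≡⟨ cong (Leq n (a ⊙ b)) (neg-involutive adm₃) ⟨
    Leq n (a ⊙ b) (∼ ∼ d)  ∼⟨ ⊙≤∼⇔Balanced adm₁ adm₂ adm∼d ⟩
    Balanced a b (∼ d)     ∼⟨ mk⇔ (Balanced-swap {a}) (Balanced-swap {a}) ⟩
    Balanced a (∼ d) b     ∼⟨ ⇔-sym (⊙≤∼⇔Balanced adm₁ adm∼d adm₂) ⟩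
    Leq n (a ⊙ ∼ d) (∼ b)  ∼⟨ mk⇔ (≤∼-swap adm-a⊙∼d adm₂) (≤∼-swap adm₂ adm-a⊙∼d) ⟩
    Leq n b (∼ (a ⊙ ∼ d))  ∎
    where
    open EquationalReasoning
    adm∼d = Admissible-neg adm₃
    adm-a⊙∼d = Admissible-⊙ adm₁ adm∼d

  ⊙-comm : ∀ {a b} → Admissible a → Admissible b → a ⊙ b ≡ b ⊙ a
  ⊙-comm {a} {b} adm₁ adm₂ = coord-injective
    (begin
      deg (a ⊙ b)    ≡⟨ deg-⊙ a b α≤p β≤p ⟩
      deg a *p deg b ≡⟨ *L-comm p (deg a) (deg b) ⟩
      deg b *p deg a ≡⟨ deg-⊙ b a β≤p α≤p ⟨
      deg (b ⊙ a)    ∎)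
    (begin
      coord (a ⊙ b)
        ≡⟨ coord-⊙ a b α≤p β≤p ⟩
      maxL (floor (deg a *p deg b)) ((coord a ⊕ coord b) ⊖ N)
        ≡⟨ cong₂ maxL (cong floor (*L-comm p (deg a) (deg b)))
                      (cong (_⊖ N) (⊕-comm (coord a) (coord b))) ⟩
      maxL (floor (deg b *p deg a)) ((coord b ⊕ coord a) ⊖ N)
        ≡⟨ coord-⊙ b a β≤p α≤p ⟨
      coord (b ⊙ a)
        ∎)
    where
    open ≡-Reasoning
    α≤p = deg≤p adm₁
    β≤p = deg≤p adm₂

  ⊙-identityʳ : ∀ {a} → Admissible a → a ⊙ top n p ≡ a
  ⊙-identityʳ {a} adm = coord-injective
    (trans (deg-⊙ a (top n p) (deg≤p adm) ℕ.≤-refl) (*L-identityʳ p (deg a)))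
    (begin
      coord (a ⊙ top n p)
        ≡⟨ coord-⊙ a (top n p) (deg≤p adm) ℕ.≤-refl ⟩
      maxL (floor (deg a *p p)) ((coord a ⊕ N) ⊖ N)
        ≡⟨ cong₂ maxL (cong floor (*L-identityʳ p (deg a))) (⊕⊖-cancel (coord a) N) ⟩
      maxL (floor (deg a)) (coord a)
        ≡⟨ maxL-right (floor≼ adm) ⟩
      coord a
        ∎)
    where open ≡-Reasoning

  floor-absorb : ∀ {d} → Admissible d → ∀ γ → ((floor γ ⊕ coord d) ⊖ N) ≼ floor (γ *p deg d)
  floor-absorb adm zero rewrite ℕ.m≤n⇒m∸n≡0 (deg≤p adm) = ⊕⊖-absorb (floor 0) (≼N adm)
  floor-absorb {d} adm (suc γ) with suc γ *p deg d in eq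
  ... | suc _ = ⊕⊖-absorb (pt (+ 0)) (≼N adm)
  ... | zero = shift≼floor0 (≼c adm δ<p)
    where
    δ<p : deg d < p
    δ<p = ℕ.≤∧≢⇒< (deg≤p adm) λ { refl → ℕ.0≢1+n (trans (sym eq) (*L-identityʳ p (suc γ))) }
    shift≼floor0 : ∀ {z} → z ≼ c → ((pt (+ 0) ⊕ z) ⊖ N) ≼ floor 0
    shift≼floor0 {z₁ , z₂} = ≼-by-difference (×-≡,≡→≡ (e₁ (+ n) z₁ , e₂ z₂))
      where
      e₁ : ∀ m z → (m - + 1) - z ≡ - + 1 - ((+ 0 + z) - m)
      e₁ = solve-∀
      e₂ : ∀ z → + 0 - z ≡ + 0 - ((+ 0 + z) - + 0)
      e₂ = solve-∀

  deg-⊙⊙ : ∀ {a b d} → Admissible a → Admissible b → Admissible d →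
           deg (a ⊙ b ⊙ d) ≡ (deg a ℕ.+ deg b ℕ.+ deg d) ∸ (p ℕ.+ p)
  deg-⊙⊙ {a} {b} {d} adm₁ adm₂ adm₃ = begin
    deg (a ⊙ b ⊙ d)                         ≡⟨ deg-⊙ (a ⊙ b) d (deg≤p adm₁₂) (deg≤p adm₃) ⟩
    deg (a ⊙ b) *p deg d                    ≡⟨ cong (_*p deg d) (deg-⊙ a b α≤p β≤p) ⟩
    (deg a *p deg b) *p deg d               ≡⟨ *L-assoc-∸ (deg a) (deg b) (deg≤p adm₃) ⟩
    (deg a ℕ.+ deg b ℕ.+ deg d) ∸ (p ℕ.+ p) ∎
    where
    open ≡-Reasoning
    α≤p = deg≤p adm₁
    β≤p = deg≤p adm₂
    adm₁₂ = Admissible-⊙ adm₁ adm₂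

  coord-⊙⊙ : ∀ {a b d} → Admissible a → Admissible b → Admissible d →
             coord (a ⊙ b ⊙ d)
               ≡ maxL (floor ((deg a ℕ.+ deg b ℕ.+ deg d) ∸ (p ℕ.+ p)))
                      ((((coord a ⊕ coord b) ⊖ N) ⊕ coord d) ⊖ N)
  coord-⊙⊙ {a} {b} {d} adm₁ adm₂ adm₃ = begin
    coord (a ⊙ b ⊙ d)
      ≡⟨ coord-⊙ (a ⊙ b) d (deg≤p (Admissible-⊙ adm₁ adm₂)) (deg≤p adm₃) ⟩
    maxL (floor (deg (a ⊙ b) *p deg d)) ((coord (a ⊙ b) ⊕ coord d) ⊖ N)
      ≡⟨ cong₂ (λ δ v → maxL (floor (δ *p deg d)) ((v ⊕ coord d) ⊖ N))
               (deg-⊙ a b (deg≤p adm₁) (deg≤p adm₂)) (coord-⊙ a b (deg≤p adm₁) (deg≤p adm₂)) ⟩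
    maxL (floor (γ *p deg d)) ((maxL (floor γ) s ⊕ coord d) ⊖ N)
      ≡⟨ cong (maxL (floor (γ *p deg d)))
              (monotone-maxL (⊕⊖-monoˡ-≼ (coord d) N) (floor γ) s) ⟩
    maxL (floor (γ *p deg d)) (maxL ((floor γ ⊕ coord d) ⊖ N) ((s ⊕ coord d) ⊖ N))
      ≡⟨ maxL-absorb (floor-absorb adm₃ γ) ⟩
    maxL (floor (γ *p deg d)) ((s ⊕ coord d) ⊖ N)
      ≡⟨ cong (λ δ → maxL (floor δ) ((s ⊕ coord d) ⊖ N))
              (*L-assoc-∸ (deg a) (deg b) (deg≤p adm₃)) ⟩
    maxL (floor ((deg a ℕ.+ deg b ℕ.+ deg d) ∸ (p ℕ.+ p))) ((s ⊕ coord d) ⊖ N)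
      ∎
    where
    open ≡-Reasoning
    γ = deg a *p deg b
    s = (coord a ⊕ coord b) ⊖ N

  ⊙-reverse : ∀ {a b d} → Admissible a → Admissible b → Admissible d →
              a ⊙ b ⊙ d ≡ d ⊙ b ⊙ a
  ⊙-reverse {a} {b} {d} adm₁ adm₂ adm₃ = coord-injective
    (trans (deg-⊙⊙ adm₁ adm₂ adm₃)
      (trans (cong (_∸ (p ℕ.+ p)) degs) (sym (deg-⊙⊙ adm₃ adm₂ adm₁))))
    (trans (coord-⊙⊙ adm₁ adm₂ adm₃)
      (trans (cong₂ maxL (cong (λ δ → floor (δ ∸ (p ℕ.+ p))) degs) coords)
             (sym (coord-⊙⊙ adm₃ adm₂ adm₁))))
    where
    degs : deg a ℕ.+ deg b ℕ.+ deg d ≡ deg d ℕ.+ deg b ℕ.+ deg a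
    degs = xy∙z≈zy∙x (deg a) (deg b) (deg d)
    coords : (((coord a ⊕ coord b) ⊖ N) ⊕ coord d) ⊖ N
           ≡ (((coord d ⊕ coord b) ⊖ N) ⊕ coord a) ⊖ N
    coords = ×-≡,≡→≡ (e (proj₁ (coord a)) (proj₁ (coord b)) (proj₁ (coord d)) (+ n) ,
                      e (proj₂ (coord a)) (proj₂ (coord b)) (proj₂ (coord d)) (+ 0))
      where
      e : ∀ x y z w → (((x + y) - w) + z) - w ≡ (((z + y) - w) + x) - w
      e = solve-∀

  ⊙-assoc : ∀ {a b d} → Admissible a → Admissible b → Admissible d →
            a ⊙ b ⊙ d ≡ a ⊙ (b ⊙ d)
  ⊙-assoc {a} {b} {d} adm₁ adm₂ adm₃ = begin
    a ⊙ b ⊙ d   ≡⟨ ⊙-reverse adm₁ adm₂ adm₃ ⟩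
    d ⊙ b ⊙ a   ≡⟨ cong (_⊙ a) (⊙-comm adm₃ adm₂) ⟩
    b ⊙ d ⊙ a   ≡⟨ ⊙-comm (Admissible-⊙ adm₂ adm₃) adm₁ ⟩
    a ⊙ (b ⊙ d) ∎
    where open ≡-Reasoning

  fromCoord : Z2 → ℕ → Raw
  fromCoord v zero = (c ⊖ v , zero)
  fromCoord v (suc k) = (v , suc k)

  coord-fromCoord : ∀ v k → coord (fromCoord v k) ≡ v
  coord-fromCoord v zero = ⊖-involutive c v
  coord-fromCoord v (suc k) = refl

  deg-fromCoord : ∀ v k → deg (fromCoord v k) ≡ k
  deg-fromCoord v zero = refl
  deg-fromCoord v (suc k) = refl

  InRange⇒Admissible : ∀ {v k} → InRange v k → Admissible (fromCoord v k)
  InRange⇒Admissible {v} {k} =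
    subst₂ InRange (sym (coord-fromCoord v k)) (sym (deg-fromCoord v k))

  ⊑-fromCoord : ∀ {a v k} → coord a ≼ v → deg a ℕ.≤ k → a ⊑ fromCoord v k
  ⊑-fromCoord {a} {v} {k} =
    curry (from (⊑⇔ {a} refl refl (coord-fromCoord v k) (deg-fromCoord v k)))

  fromCoord-⊑ : ∀ {a v k} → v ≼ coord a → k ℕ.≤ deg a → fromCoord v k ⊑ a
  fromCoord-⊑ {a} {v} {k} =
    curry (from (⊑⇔ {b = a} (coord-fromCoord v k) (deg-fromCoord v k) refl refl))

  meet join : Raw → Raw → Raw
  meet a b = fromCoord (minL (coord a) (coord b)) (deg a ⊓ deg b)
  join a b = fromCoord (maxL (coord a) (coord b)) (deg a ⊔ deg b)

  Admissible-meet : ∀ {a b} → Admissible a → Admissible b → Admissible (meet a b)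
  Admissible-meet {a} {b} adm₁ adm₂ = InRange⇒Admissible (record
    { floor≼ = minL-glb (≼-trans (floor-mono (ℕ.m⊓n≤m (deg a) (deg b))) (floor≼ adm₁))
                        (≼-trans (floor-mono (ℕ.m⊓n≤n (deg a) (deg b))) (floor≼ adm₂))
    ; ≼N = ≼-trans (minL≼x (coord a) (coord b)) (≼N adm₁)
    ; deg≤p = ℕ.≤-trans (ℕ.m⊓n≤m (deg a) (deg b)) (deg≤p adm₁)
    ; ≼c = ≼c′ (ℕ.⊓-sel (deg a) (deg b))
    })
    where
    ≼c′ : deg a ⊓ deg b ≡ deg a ⊎ deg a ⊓ deg b ≡ deg b →
          deg a ⊓ deg b < p → minL (coord a) (coord b) ≼ c
    ≼c′ (inj₁ eq) lt = ≼-trans (minL≼x (coord a) (coord b)) (≼c adm₁ (subst (_< p) eq lt))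
    ≼c′ (inj₂ eq) lt = ≼-trans (minL≼y (coord a) (coord b)) (≼c adm₂ (subst (_< p) eq lt))

  Admissible-join : ∀ {a b} → Admissible a → Admissible b → Admissible (join a b)
  Admissible-join {a} {b} adm₁ adm₂ = InRange⇒Admissible (record
    { floor≼ = floor≼′ (ℕ.⊔-sel (deg a) (deg b))
    ; ≼N = maxL-lub (≼N adm₁) (≼N adm₂)
    ; deg≤p = ℕ.⊔-lub (deg≤p adm₁) (deg≤p adm₂)
    ; ≼c = λ lt → maxL-lub (≼c adm₁ (ℕ.m⊔n<o⇒m<o _ _ lt)) (≼c adm₂ (ℕ.m⊔n<o⇒n<o _ _ lt))
    })
    where
    x = maxL (coord a) (coord b)
    floor≼′ : deg a ⊔ deg b ≡ deg a ⊎ deg a ⊔ deg b ≡ deg b → floor (deg a ⊔ deg b) ≼ x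
    floor≼′ (inj₁ eq) =
      subst (λ k → floor k ≼ x) (sym eq) (≼-trans (floor≼ adm₁) (x≼maxL (coord a) (coord b)))
    floor≼′ (inj₂ eq) =
      subst (λ k → floor k ≼ x) (sym eq) (≼-trans (floor≼ adm₂) (y≼maxL (coord a) (coord b)))

  meet-⊑ˡ : ∀ a b → meet a b ⊑ a
  meet-⊑ˡ a b = fromCoord-⊑ (minL≼x (coord a) (coord b)) (ℕ.m⊓n≤m (deg a) (deg b))

  meet-⊑ʳ : ∀ a b → meet a b ⊑ b
  meet-⊑ʳ a b = fromCoord-⊑ (minL≼y (coord a) (coord b)) (ℕ.m⊓n≤n (deg a) (deg b))

  meet-greatest : ∀ {a b d} → d ⊑ a → d ⊑ b → d ⊑ meet a b
  meet-greatest (x≼ , α≤) (y≼ , β≤) = ⊑-fromCoord (minL-glb x≼ y≼) (ℕ.⊓-glb α≤ β≤)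

  join-⊒ˡ : ∀ a b → a ⊑ join a b
  join-⊒ˡ a b = ⊑-fromCoord (x≼maxL (coord a) (coord b)) (ℕ.m≤m⊔n (deg a) (deg b))

  join-⊒ʳ : ∀ a b → b ⊑ join a b
  join-⊒ʳ a b = ⊑-fromCoord (y≼maxL (coord a) (coord b)) (ℕ.m≤n⊔m (deg a) (deg b))

  join-least : ∀ {a b d} → a ⊑ d → b ⊑ d → join a b ⊑ d
  join-least (≼x , ≤α) (≼y , ≤β) = fromCoord-⊑ (maxL-lub ≼x ≼y) (ℕ.⊔-lub ≤α ≤β)

  ⊥-⊑ : ∀ {a} → Admissible a → bot n p ⊑ a
  ⊥-⊑ {a} adm =
    subst (_≼ coord a) (sym c⊖N≡floor0) (≼-trans (floor0≼ (deg a)) (floor≼ adm)) , z≤n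

  ⊑-⊤ : ∀ {a} → Admissible a → a ⊑ top n p
  ⊑-⊤ adm = ≼N adm , deg≤p adm

  isBICRL : IsBICRL (InA n p) (Leq n) _⊙_ (lolli n p) (bot n p) (top n p)
  isBICRL = record
    { ⊙-closed = λ ia ib → Admissible⇒InA (Admissible-⊙ (adm ia) (adm ib))
    ; ⊸-closed = λ ia ib →
        Admissible⇒InA (Admissible-neg (Admissible-⊙ (adm ia) (Admissible-neg (adm ib))))
    ; ⊥-in = Admissible⇒InA Admissible-⊥
    ; ⊤-in = Admissible⇒InA Admissible-⊤
    ; ≤-refl = λ _ → ⊑⇒Leq (≼-refl , ℕ.≤-refl)
    ; ≤-antisym = λ _ _ h₁ h₂ → ⊑-antisym (Leq⇒⊑ h₁) (Leq⇒⊑ h₂)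
    ; ≤-trans = λ _ _ _ h₁ h₂ → ⊑⇒Leq (⊑-trans (Leq⇒⊑ h₁) (Leq⇒⊑ h₂))
    ; meet = λ {a} {b} ia ib →
        meet a b , Admissible⇒InA (Admissible-meet (adm ia) (adm ib)) ,
        ⊑⇒Leq (meet-⊑ˡ a b) , ⊑⇒Leq (meet-⊑ʳ a b) ,
        λ _ h₁ h₂ → ⊑⇒Leq (meet-greatest (Leq⇒⊑ h₁) (Leq⇒⊑ h₂))
    ; join = λ {a} {b} ia ib →
        join a b , Admissible⇒InA (Admissible-join (adm ia) (adm ib)) ,
        ⊑⇒Leq (join-⊒ˡ a b) , ⊑⇒Leq (join-⊒ʳ a b) ,
        λ _ h₁ h₂ → ⊑⇒Leq (join-least (Leq⇒⊑ h₁) (Leq⇒⊑ h₂))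
    ; ⊥-least = λ ia → ⊑⇒Leq (⊥-⊑ (adm ia))
    ; ⊤-greatest = λ ia → ⊑⇒Leq (⊑-⊤ (adm ia))
    ; ⊙-assoc = λ ia ib ic → ⊙-assoc (adm ia) (adm ib) (adm ic)
    ; ⊙-comm = λ ia ib → ⊙-comm (adm ia) (adm ib)
    ; ⊙-identʳ = λ ia → ⊙-identityʳ (adm ia)
    ; residuated = λ {a} {b} {d} ia ib id →
        subst (λ w → Leq n w d ⇔ Leq n a (lolli n p b d)) (⊙-comm (adm ib) (adm ia))
              (residuation (adm ib) (adm ia) (adm id))
    }
    where
    adm : ∀ {a} → InA n p a → Admissible a
    adm = InA⇒Admissible

theorem2p5 : (n p : ℕ) → 0 < n → 0 < p →
    ((a b c : Raw) → InA n p a → InA n p b → InA n p c →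
      (Leq n (odot n p a b) c ⇔ Leq n b (lolli n p a c)))
    × IsBICRL (InA n p) (Leq n) (odot n p) (lolli n p) (bot n p) (top n p)
theorem2p5 zero _ () _
theorem2p5 _ zero _ ()
theorem2p5 (suc n₀) (suc p₀) _ _ =
  (λ _ _ _ ia ib ic → residuation n₀ p₀ (adm ia) (adm ib) (adm ic)) , isBICRL n₀ p₀
  where
  adm : ∀ {a} → InA (suc n₀) (suc p₀) a → Admissible n₀ p₀ a
  adm = InA⇒Admissible n₀ p₀
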